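{- Let $q\ge 5$ be an integer and let $a_n,b_n,c_n,d_n,e_n$ ($n\ge 0$) be the numbers of vertices of types $A,B,C,D,E$, respectively, on level $n$ of the Pascal pyramid $\mathcal{PP}_{4,q}$ in $\mathbf{H}^2\times\mathbf{R}$ (defined in the context). Then $a_1=b_1=c_1=d_1=e_1=0$ and for every $n\ge 1$: $$a_{n+1}=a_n+b_n+1,\quad b_{n+1}=(q-4)a_n+(q-3)b_n,\quad c_{n+1}=c_n+2,\quad d_{n+1}=a_n+d_n,\quad e_{n+1}=b_n+e_n.$$
   Context: Fix an integer $q\ge5$ and the regular tiling $\{4,q\}$ of the hyperbolic plane by congruent squares, $q$ squares meeting at each vertex; let $d$ be the edge length. Hyperbolic Pascal triangle $\mathcal{HPT}$ (a subgraph of the tiling), built row by row. Row $0$ is a single base vertex $V_0$. The leftmost and rightmost vertices of each row $j\ge1$ are called wingers; every other vertex of row $j\ge 2$ has type $A$ or $B$. From each vertex of row $j$ one draws, in order from left to right, its descending edges (tiling edges going away from $V_0$): $2$ from $V_0$ and from each winger, $q-2$ from each vertex of type $A$, $q-1$ from each vertex of type $B$. For two consecutive vertices of row $j$, the rightmost descending edge of the left one and the leftmost descending edge of the right one end at a common vertex of row $j+1$, which is of type $A$; the two outermost descending edges of row $j$ end at the two wingers of row $j+1$; all remaining descending edges end at distinct vertices of row $j+1$, which are of type $B$. (Thus row $n$ consists of the vertices at graph distance $n$ from $V_0$; a non-winger has type $A$ iff it has two neighbours in the previous row, type $B$ iff it has one.) Pascal pyramid $\mathcal{PP}_{4,q}$.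 Place $\mathcal{HPT}$ in the plane $\mathbf{H}^2\times\{0\}$ of $\mathbf{H}^2\times\mathbf{R}$ and copy it to the planes $\mathbf{H}^2\times\{kd\}$, $k=1,2,\dots$, with corresponding vertices on the same fibre $\{v\}\times\mathbf{R}$ (this is part of the tiling of $\mathbf{H}^2\times\mathbf{R}$ by square prisms over $\{4,q\}$ of height $d$). The vertices are the pairs $(v,k)$, $v$ a vertex of $\mathcal{HPT}$, $k\in\mathbb{Z}_{\ge0}$; edges join $(v,k)$–$(w,k)$ whenever $vw$ is an edge of $\mathcal{HPT}$, and $(v,k)$–$(v,k+1)$. Level $n$ is the set of vertices at edge-distance $n$ from $(V_0,0)$, i.e. of $(v,k)$ with $v$ in row $r$ of $\mathcal{HPT}$ and $r+k=n$. The value of a vertex is the number of shortest edge paths from $(V_0,0)$ to it. Vertex types on level $n\ge1$: type $1$: $(V_0,k)$ with $k\ge1$, and $(w,0)$ with $w$ a winger; type $A$ (resp. $B$): $(v,0)$ with $v$ of type $A$ (resp. $B$) in $\mathcal{HPT}$; type $C$: $(w,k)$ with $w$ a winger and $k\ge1$; type $D$ (resp. $E$): $(v,k)$ with $k\ge1$ and $v$ of type $A$ (resp. $B$) in $\mathcal{HPT}$. (The level-$0$ vertex $(V_0,0)$ has none of the types $A,\dots,E$.) -}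

module Defs where

open import Data.Nat using (ℕ; zero; suc; _+_; _∸_; _≡ᵇ_)
open import Data.Bool using (Bool; if_then_else_)
open import Data.List using (List; []; _∷_; _++_; replicate; map; concatMap; upTo; length)

data HType : Set where
  base   : HType
  winger : HType
  typeA  : HType
  typeB  : HType

-- number of descending edges of a vertex
desc : ℕ → HType → ℕ
desc q base   = 2
desc q winger = 2
desc q typeA  = q ∸ 2
desc q typeB  = q ∸ 1

-- Building row j+1 from row j (vertices listed left to right):
-- the outermost descending edges end at wingers, the shared edge of two
-- consecutive vertices ends at a type A vertex, all other descending
-- edges (desc - 2 per vertex) end at distinct type B vertices.
nextRest : ℕ → List HType → List HType
nextRest q []       = winger ∷ []
nextRest q (t ∷ ts) = typeA ∷ (replicate (desc q t ∸ 2) typeB ++ nextRest q ts)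

nextRow : ℕ → List HType → List HType
nextRow q []       = []
nextRow q (t ∷ ts) = winger ∷ (replicate (desc q t ∸ 2) typeB ++ nextRest q ts)

row : ℕ → ℕ → List HType
row q zero    = base ∷ []
row q (suc j) = nextRow q (row q j)

data PType : Set where
  none  : PType   -- only (V₀,0)
  type1 : PType
  pA pB pC pD pE : PType

-- type of the pyramid vertex (v,k), v of kind t in HPT
classify : HType → ℕ → PType
classify base   zero    = none
classify base   (suc k) = type1
classify winger zero    = type1
classify winger (suc k) = pC
classify typeA  zero    = pA
classify typeA  (suc k) = pD
classify typeB  zero    = pB
classify typeB  (suc k) = pE

-- level n: all (v,k) with v in row r and r + k = n, r = 0..n
level : ℕ → ℕ → List PType
level q n = concatMap (λ r → map (λ t → classify t (n ∸ r)) (row q r)) (upTo (suc n))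

code : PType → ℕ
code none  = 0
code type1 = 1
code pA    = 2
code pB    = 3
code pC    = 4
code pD    = 5
code pE    = 6

count : PType → List PType → ℕ
count p []       = 0
count p (x ∷ xs) = if code x ≡ᵇ code p then suc (count p xs) else count p xs

numType : ℕ → PType → ℕ → ℕ
numType q p n = count p (level q n)

-- Level n of the pyramid is row n of the triangle lying in the base plane,
-- together with lifted copies of all rows r < n.  Types A and B occur only
-- in the base plane, so a_n and b_n are the numbers of A- and B-vertices of
-- row n; types C, D, E occur only above it, and level n + 1 contains exactly
-- one more lifted row than level n, namely row n, so c, d, e grow by the
-- numbers of wingers, A- and B-vertices of row n.
-- For the triangle: row j + 1 is a winger followed by a list R of vertices
-- containing one more winger and no V₀.  Row j + 2 has one A-vertex for each
-- vertex of R and desc(t) − 2 B-vertices for each t in R, that is q − 4 per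
-- A-vertex and q − 3 per B-vertex.
module Submission where

open import Defs
open import Data.Nat using (ℕ; zero; suc; _+_; _*_; _∸_; _≤_; _<_; _≡ᵇ_)
open import Data.Nat.Properties using (+-identityʳ; +-assoc; +-comm; *-zeroʳ; *-identityʳ; n∸n≡0; m<n⇒0<n∸m; ∸-+-assoc)
open import Data.Nat.ListAction using (sum)
open import Data.Nat.ListAction.Properties using (sum-++)
open import Data.Nat.Tactic.RingSolver using (solve-∀)
open import Data.Bool using (true; false)
open import Data.List using (List; []; _∷_; _++_; [_]; replicate; map; concat; concatMap; upTo; length)
open import Data.List.Properties using (map-++; map-cong; map-cong-local; concatMap-++; map-concatMap; upTo-∷ʳ; ++-identityʳ)
import Data.List.Relation.Unary.All as All
open import Data.List.Relation.Unary.All.Properties using (all-upTo)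
open import Data.Product using (_×_; _,_)
open import Function using (_∘_)
open import Relation.Binary.PropositionalEquality using (_≡_; _≗_; refl; sym; trans; cong; cong₂; module ≡-Reasoning)

open ≡-Reasoning

tally : (HType → ℕ) → List HType → ℕ
tally f ts = sum (map f ts)

tally-++ : ∀ f xs ys → tally f (xs ++ ys) ≡ tally f xs + tally f ys
tally-++ f xs ys = trans (cong sum (map-++ f xs ys)) (sum-++ (map f xs) (map f ys))

tally-cong : ∀ {f g} → f ≗ g → tally f ≗ tally g
tally-cong f≗g = cong sum ∘ map-cong f≗g

tally-zero : ∀ {f} → (∀ t → f t ≡ 0) → ∀ ts → tally f ts ≡ 0
tally-zero f≡0 []       = refl
tally-zero f≡0 (t ∷ ts) = cong₂ _+_ (f≡0 t) (tally-zero f≡0 ts)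

tally-replicate : ∀ f n t → tally f (replicate n t) ≡ n * f t
tally-replicate f zero    t = refl
tally-replicate f (suc n) t = cong (f t +_) (tally-replicate f n t)

isTypeA isTypeB isWinger isBase : HType → ℕ
isTypeA typeA  = 1
isTypeA _      = 0
isTypeB typeB  = 1
isTypeB _      = 0
isWinger winger = 1
isWinger _      = 0
isBase base = 1
isBase _    = 0

length-tally : ∀ ts → length ts ≡ tally isTypeA ts + tally isTypeB ts + tally isWinger ts + tally isBase ts
length-tally []       = refl
length-tally (t ∷ ts) = begin
  1 + length ts
    ≡⟨ cong₂ _+_ (one-kind t) (length-tally ts) ⟩
  (isTypeA t + isTypeB t + isWinger t + isBase t) + (tally isTypeA ts + tally isTypeB ts + tally isWinger ts + tally isBase ts)
    ≡⟨ regroup (isTypeA t) (isTypeB t) (isWinger t) (isBase t) _ _ _ _ ⟩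
  tally isTypeA (t ∷ ts) + tally isTypeB (t ∷ ts) + tally isWinger (t ∷ ts) + tally isBase (t ∷ ts) ∎
  where
  one-kind : ∀ t → 1 ≡ isTypeA t + isTypeB t + isWinger t + isBase t
  one-kind base   = refl
  one-kind winger = refl
  one-kind typeA  = refl
  one-kind typeB  = refl

  regroup : ∀ a b w v a′ b′ w′ v′ → (a + b + w + v) + (a′ + b′ + w′ + v′) ≡ (a + a′) + (b + b′) + (w + w′) + (v + v′)
  regroup = solve-∀

desc∸2-linear : ∀ q t → desc q t ∸ 2 ≡ (q ∸ 4) * isTypeA t + (q ∸ 3) * isTypeB t
desc∸2-linear q base   = sym (cong₂ _+_ (*-zeroʳ (q ∸ 4)) (*-zeroʳ (q ∸ 3)))
desc∸2-linear q winger = sym (cong₂ _+_ (*-zeroʳ (q ∸ 4)) (*-zeroʳ (q ∸ 3)))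
desc∸2-linear q typeA  = trans (∸-+-assoc q 2 2) (first (q ∸ 4) (q ∸ 3))
  where
  first : ∀ x y → x ≡ x * 1 + y * 0
  first = solve-∀
desc∸2-linear q typeB  = trans (∸-+-assoc q 1 2) (second (q ∸ 4) (q ∸ 3))
  where
  second : ∀ x y → y ≡ x * 0 + y * 1
  second = solve-∀

tally-linear : ∀ a b f g ts → tally (λ t → a * f t + b * g t) ts ≡ a * tally f ts + b * tally g ts
tally-linear a b f g []       = sym (cong₂ _+_ (*-zeroʳ a) (*-zeroʳ b))
tally-linear a b f g (t ∷ ts) = trans (cong (a * f t + b * g t +_) (tally-linear a b f g ts))
                                      (distribute a b (f t) (g t) (tally f ts) (tally g ts))
  where
  distribute : ∀ a b x y X Y → a * x + b * y + (a * X + b * Y) ≡ a * (x + X) + b * (y + Y)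
  distribute = solve-∀

tally-nextRest-∷ : ∀ f q t ts → tally f (nextRest q (t ∷ ts)) ≡ f typeA + ((desc q t ∸ 2) * f typeB + tally f (nextRest q ts))
tally-nextRest-∷ f q t ts = cong (f typeA +_) (begin
  tally f (replicate (desc q t ∸ 2) typeB ++ nextRest q ts)
    ≡⟨ tally-++ f (replicate (desc q t ∸ 2) typeB) (nextRest q ts) ⟩
  tally f (replicate (desc q t ∸ 2) typeB) + tally f (nextRest q ts)
    ≡⟨ cong (_+ tally f (nextRest q ts)) (tally-replicate f (desc q t ∸ 2) typeB) ⟩
  (desc q t ∸ 2) * f typeB + tally f (nextRest q ts) ∎)

tally-nextRest-typeA : ∀ q ts → tally isTypeA (nextRest q ts) ≡ length ts
tally-nextRest-typeA q []       = refl
tally-nextRest-typeA q (t ∷ ts) = trans (tally-nextRest-∷ isTypeA q t ts)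
  (cong suc (cong₂ _+_ (*-zeroʳ (desc q t ∸ 2)) (tally-nextRest-typeA q ts)))

tally-nextRest-typeB : ∀ q ts → tally isTypeB (nextRest q ts) ≡ tally (λ t → desc q t ∸ 2) ts
tally-nextRest-typeB q []       = refl
tally-nextRest-typeB q (t ∷ ts) = trans (tally-nextRest-∷ isTypeB q t ts)
  (cong₂ _+_ (*-identityʳ (desc q t ∸ 2)) (tally-nextRest-typeB q ts))

tally-nextRest-winger : ∀ q ts → tally isWinger (nextRest q ts) ≡ 1
tally-nextRest-winger q []       = refl
tally-nextRest-winger q (t ∷ ts) = trans (tally-nextRest-∷ isWinger q t ts)
  (cong₂ _+_ (*-zeroʳ (desc q t ∸ 2)) (tally-nextRest-winger q ts))

tally-nextRest-base : ∀ q ts → tally isBase (nextRest q ts) ≡ 0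
tally-nextRest-base q []       = refl
tally-nextRest-base q (t ∷ ts) = trans (tally-nextRest-∷ isBase q t ts)
  (cong₂ _+_ (*-zeroʳ (desc q t ∸ 2)) (tally-nextRest-base q ts))

rowTail : ℕ → ℕ → List HType
rowTail q zero    = winger ∷ []
rowTail q (suc j) = nextRest q (rowTail q j)

row-suc : ∀ q j → row q (suc j) ≡ winger ∷ rowTail q j
row-suc q zero    = refl
row-suc q (suc j) = cong (nextRow q) (row-suc q j)

tally-rowTail-winger : ∀ q j → tally isWinger (rowTail q j) ≡ 1
tally-rowTail-winger q zero    = refl
tally-rowTail-winger q (suc j) = tally-nextRest-winger q (rowTail q j)

tally-rowTail-base : ∀ q j → tally isBase (rowTail q j) ≡ 0
tally-rowTail-base q zero    = refl
tally-rowTail-base q (suc j) = tally-nextRest-base q (rowTail q j)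

tally-row-winger : ∀ q j → tally isWinger (row q (suc j)) ≡ 2
tally-row-winger q j = trans (cong (tally isWinger) (row-suc q j)) (cong suc (tally-rowTail-winger q j))

tally-rowTail-typeA-suc : ∀ q j →
  tally isTypeA (rowTail q (suc j)) ≡ tally isTypeA (rowTail q j) + tally isTypeB (rowTail q j) + 1
tally-rowTail-typeA-suc q j = begin
  tally isTypeA (nextRest q R)     ≡⟨ tally-nextRest-typeA q R ⟩
  length R                         ≡⟨ length-tally R ⟩
  a + b + tally isWinger R + tally isBase R
    ≡⟨ cong₂ (λ w v → a + b + w + v) (tally-rowTail-winger q j) (tally-rowTail-base q j) ⟩
  a + b + 1 + 0                    ≡⟨ +-identityʳ (a + b + 1) ⟩
  a + b + 1                        ∎
  where
  R = rowTail q j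
  a = tally isTypeA R
  b = tally isTypeB R

tally-rowTail-typeB-suc : ∀ q j →
  tally isTypeB (rowTail q (suc j)) ≡ (q ∸ 4) * tally isTypeA (rowTail q j) + (q ∸ 3) * tally isTypeB (rowTail q j)
tally-rowTail-typeB-suc q j = begin
  tally isTypeB (nextRest q R)     ≡⟨ tally-nextRest-typeB q R ⟩
  tally (λ t → desc q t ∸ 2) R     ≡⟨ tally-cong (desc∸2-linear q) R ⟩
  tally (λ t → (q ∸ 4) * isTypeA t + (q ∸ 3) * isTypeB t) R
    ≡⟨ tally-linear (q ∸ 4) (q ∸ 3) isTypeA isTypeB R ⟩
  (q ∸ 4) * tally isTypeA R + (q ∸ 3) * tally isTypeB R ∎
  where
  R = rowTail q j

count₁ : PType → PType → ℕ
count₁ p x = count p [ x ]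

count-∷ : ∀ p x xs → count p (x ∷ xs) ≡ count₁ p x + count p xs
count-∷ p x xs with code x ≡ᵇ code p
... | true  = refl
... | false = refl

count-++ : ∀ p xs ys → count p (xs ++ ys) ≡ count p xs + count p ys
count-++ p []       ys = refl
count-++ p (x ∷ xs) ys = begin
  count p (x ∷ xs ++ ys)              ≡⟨ count-∷ p x (xs ++ ys) ⟩
  count₁ p x + count p (xs ++ ys)     ≡⟨ cong (count₁ p x +_) (count-++ p xs ys) ⟩
  count₁ p x + (count p xs + count p ys)
    ≡⟨ sym (+-assoc (count₁ p x) (count p xs) (count p ys)) ⟩
  count₁ p x + count p xs + count p ys ≡⟨ cong (_+ count p ys) (sym (count-∷ p x xs)) ⟩
  count p (x ∷ xs) + count p ys       ∎

count-map : ∀ p (g : HType → PType) ts → count p (map g ts) ≡ tally (count₁ p ∘ g) ts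
count-map p g []       = refl
count-map p g (t ∷ ts) = trans (count-∷ p (g t) (map g ts)) (cong (count₁ p (g t) +_) (count-map p g ts))

classifyAbove : HType → PType
classifyAbove base   = type1
classifyAbove winger = pC
classifyAbove typeA  = pD
classifyAbove typeB  = pE

classify-above : ∀ t {k} → 0 < k → classify t k ≡ classifyAbove t
classify-above base   {suc k} _ = refl
classify-above winger {suc k} _ = refl
classify-above typeA  {suc k} _ = refl
classify-above typeB  {suc k} _ = refl

rowsBefore : ℕ → ℕ → List HType
rowsBefore q n = concatMap (row q) (upTo n)

rowsBefore-suc : ∀ q n → rowsBefore q (suc n) ≡ rowsBefore q n ++ row q n
rowsBefore-suc q n = begin
  concatMap (row q) (upTo (suc n))            ≡⟨ cong (concatMap (row q)) (sym (upTo-∷ʳ n)) ⟩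
  concatMap (row q) (upTo n ++ [ n ])         ≡⟨ concatMap-++ (row q) (upTo n) [ n ] ⟩
  rowsBefore q n ++ (row q n ++ [])           ≡⟨ cong (rowsBefore q n ++_) (++-identityʳ (row q n)) ⟩
  rowsBefore q n ++ row q n                   ∎

level-split : ∀ q n → level q n ≡ map classifyAbove (rowsBefore q n) ++ map (λ t → classify t 0) (row q n)
level-split q n = begin
  concatMap layer (upTo (suc n))                           ≡⟨ cong (concatMap layer) (sym (upTo-∷ʳ n)) ⟩
  concatMap layer (upTo n ++ [ n ])                        ≡⟨ concatMap-++ layer (upTo n) [ n ] ⟩
  concatMap layer (upTo n) ++ (layer n ++ [])              ≡⟨ cong₂ _++_ lifted ground ⟩
  concatMap (map classifyAbove ∘ row q) (upTo n) ++ map (λ t → classify t 0) (row q n)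
    ≡⟨ cong (_++ map (λ t → classify t 0) (row q n)) (sym (map-concatMap classifyAbove (row q) (upTo n))) ⟩
  map classifyAbove (rowsBefore q n) ++ map (λ t → classify t 0) (row q n) ∎
  where
  layer : ℕ → List PType
  layer r = map (λ t → classify t (n ∸ r)) (row q r)

  lifted : concatMap layer (upTo n) ≡ concatMap (map classifyAbove ∘ row q) (upTo n)
  lifted = cong concat (map-cong-local (All.map
    (λ r<n → map-cong (λ t → classify-above t (m<n⇒0<n∸m r<n)) _) (all-upTo n)))

  ground : layer n ++ [] ≡ map (λ t → classify t 0) (row q n)
  ground = trans (++-identityʳ (layer n)) (map-cong (λ t → cong (classify t) (n∸n≡0 n)) (row q n))

numType-split : ∀ q p n → numType q p n ≡
  tally (count₁ p ∘ classifyAbove) (rowsBefore q n) + tally (λ t → count₁ p (classify t 0)) (row q n)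
numType-split q p n = begin
  count p (level q n)
    ≡⟨ cong (count p) (level-split q n) ⟩
  count p (map classifyAbove (rowsBefore q n) ++ map (λ t → classify t 0) (row q n))
    ≡⟨ count-++ p (map classifyAbove (rowsBefore q n)) _ ⟩
  count p (map classifyAbove (rowsBefore q n)) + count p (map (λ t → classify t 0) (row q n))
    ≡⟨ cong₂ _+_ (count-map p classifyAbove (rowsBefore q n)) (count-map p (λ t → classify t 0) (row q n)) ⟩
  tally (count₁ p ∘ classifyAbove) (rowsBefore q n) + tally (λ t → count₁ p (classify t 0)) (row q n) ∎

numType-ground : ∀ q p f → (∀ t → count₁ p (classifyAbove t) ≡ 0) → (∀ t → count₁ p (classify t 0) ≡ f t) →
  ∀ n → numType q p n ≡ tally f (row q n)
numType-ground q p f above≡0 ground≡f n = begin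
  numType q p n ≡⟨ numType-split q p n ⟩
  tally (count₁ p ∘ classifyAbove) (rowsBefore q n) + tally (λ t → count₁ p (classify t 0)) (row q n)
    ≡⟨ cong₂ _+_ (tally-zero above≡0 (rowsBefore q n)) (tally-cong ground≡f (row q n)) ⟩
  tally f (row q n) ∎

numType-above : ∀ q p → (∀ t → count₁ p (classify t 0) ≡ 0) →
  ∀ n → numType q p n ≡ tally (count₁ p ∘ classifyAbove) (rowsBefore q n)
numType-above q p ground≡0 n = begin
  numType q p n ≡⟨ numType-split q p n ⟩
  tally (count₁ p ∘ classifyAbove) (rowsBefore q n) + tally (λ t → count₁ p (classify t 0)) (row q n)
    ≡⟨ cong (tally (count₁ p ∘ classifyAbove) (rowsBefore q n) +_) (tally-zero ground≡0 (row q n)) ⟩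
  tally (count₁ p ∘ classifyAbove) (rowsBefore q n) + 0
    ≡⟨ +-identityʳ _ ⟩
  tally (count₁ p ∘ classifyAbove) (rowsBefore q n) ∎

numType-above-suc : ∀ q p f → (∀ t → count₁ p (classify t 0) ≡ 0) → (∀ t → count₁ p (classifyAbove t) ≡ f t) →
  ∀ n → numType q p (suc n) ≡ numType q p n + tally f (row q n)
numType-above-suc q p f ground≡0 above≡f n = begin
  numType q p (suc n)                      ≡⟨ numType-above q p ground≡0 (suc n) ⟩
  tally F (rowsBefore q (suc n))           ≡⟨ cong (tally F) (rowsBefore-suc q n) ⟩
  tally F (rowsBefore q n ++ row q n)      ≡⟨ tally-++ F (rowsBefore q n) (row q n) ⟩
  tally F (rowsBefore q n) + tally F (row q n)
    ≡⟨ cong₂ _+_ (sym (numType-above q p ground≡0 n)) (tally-cong above≡f (row q n)) ⟩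
  numType q p n + tally f (row q n)        ∎
  where
  F = count₁ p ∘ classifyAbove

numType-typeA : ∀ q n → numType q pA n ≡ tally isTypeA (row q n)
numType-typeA q = numType-ground q pA isTypeA
  (λ { base → refl ; winger → refl ; typeA → refl ; typeB → refl })
  (λ { base → refl ; winger → refl ; typeA → refl ; typeB → refl })

numType-typeA-suc : ∀ q j → numType q pA (suc j) ≡ tally isTypeA (rowTail q j)
numType-typeA-suc q j = trans (numType-typeA q (suc j)) (cong (tally isTypeA) (row-suc q j))

numType-typeB : ∀ q n → numType q pB n ≡ tally isTypeB (row q n)
numType-typeB q = numType-ground q pB isTypeB
  (λ { base → refl ; winger → refl ; typeA → refl ; typeB → refl })
  (λ { base → refl ; winger → refl ; typeA → refl ; typeB → refl })

numType-typeB-suc : ∀ q j → numType q pB (suc j) ≡ tally isTypeB (rowTail q j)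
numType-typeB-suc q j = trans (numType-typeB q (suc j)) (cong (tally isTypeB) (row-suc q j))

numType-typeC-suc : ∀ q n → numType q pC (suc n) ≡ numType q pC n + tally isWinger (row q n)
numType-typeC-suc q = numType-above-suc q pC isWinger
  (λ { base → refl ; winger → refl ; typeA → refl ; typeB → refl })
  (λ { base → refl ; winger → refl ; typeA → refl ; typeB → refl })

numType-typeD-suc : ∀ q n → numType q pD (suc n) ≡ numType q pD n + tally isTypeA (row q n)
numType-typeD-suc q = numType-above-suc q pD isTypeA
  (λ { base → refl ; winger → refl ; typeA → refl ; typeB → refl })
  (λ { base → refl ; winger → refl ; typeA → refl ; typeB → refl })

numType-typeE-suc : ∀ q n → numType q pE (suc n) ≡ numType q pE n + tally isTypeB (row q n)
numType-typeE-suc q = numType-above-suc q pE isTypeB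
  (λ { base → refl ; winger → refl ; typeA → refl ; typeB → refl })
  (λ { base → refl ; winger → refl ; typeA → refl ; typeB → refl })

numType-typeA-recurrence : ∀ q j → numType q pA (2 + j) ≡ numType q pA (1 + j) + numType q pB (1 + j) + 1
numType-typeA-recurrence q j = begin
  numType q pA (2 + j)                                           ≡⟨ numType-typeA-suc q (suc j) ⟩
  tally isTypeA (rowTail q (suc j))                              ≡⟨ tally-rowTail-typeA-suc q j ⟩
  tally isTypeA (rowTail q j) + tally isTypeB (rowTail q j) + 1
    ≡⟨ sym (cong₂ (λ a b → a + b + 1) (numType-typeA-suc q j) (numType-typeB-suc q j)) ⟩
  numType q pA (1 + j) + numType q pB (1 + j) + 1                ∎

numType-typeB-recurrence : ∀ q j →
  numType q pB (2 + j) ≡ (q ∸ 4) * numType q pA (1 + j) + (q ∸ 3) * numType q pB (1 + j)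
numType-typeB-recurrence q j = begin
  numType q pB (2 + j)                                           ≡⟨ numType-typeB-suc q (suc j) ⟩
  tally isTypeB (rowTail q (suc j))                              ≡⟨ tally-rowTail-typeB-suc q j ⟩
  (q ∸ 4) * tally isTypeA (rowTail q j) + (q ∸ 3) * tally isTypeB (rowTail q j)
    ≡⟨ sym (cong₂ (λ a b → (q ∸ 4) * a + (q ∸ 3) * b) (numType-typeA-suc q j) (numType-typeB-suc q j)) ⟩
  (q ∸ 4) * numType q pA (1 + j) + (q ∸ 3) * numType q pB (1 + j) ∎

theorem1 : (q : ℕ) → 5 ≤ q →
    (numType q pA 1 ≡ 0 × numType q pB 1 ≡ 0 × numType q pC 1 ≡ 0
      × numType q pD 1 ≡ 0 × numType q pE 1 ≡ 0)
    × ((n : ℕ) → 1 ≤ n →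
        numType q pA (1 + n) ≡ numType q pA n + numType q pB n + 1
        × numType q pB (1 + n) ≡ (q ∸ 4) * numType q pA n + (q ∸ 3) * numType q pB n
        × numType q pC (1 + n) ≡ numType q pC n + 2
        × numType q pD (1 + n) ≡ numType q pA n + numType q pD n
        × numType q pE (1 + n) ≡ numType q pB n + numType q pE n)
theorem1 q _ = (refl , refl , refl , refl , refl) , λ where
  (suc j) _ →
      numType-typeA-recurrence q j
    , numType-typeB-recurrence q j
    , trans (numType-typeC-suc q (suc j)) (cong (numType q pC (suc j) +_) (tally-row-winger q j))
    , trans (numType-typeD-suc q (suc j)) (trans (+-comm (numType q pD (suc j)) _)
        (cong (_+ numType q pD (suc j)) (sym (numType-typeA q (suc j)))))
    , trans (numType-typeE-suc q (suc j)) (trans (+-comm (numType q pE (suc j)) _)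
        (cong (_+ numType q pE (suc j)) (sym (numType-typeB q (suc j)))))
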